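{- Let $\varepsilon\colon X^{\times}_{\mathrm{irr}}\to\mathcal{P}(M)$ be a Fitch map, let $(T,\lambda)$ be any edge-labeled tree that explains $\varepsilon$, and let $\widehat{T}(\varepsilon)$ be the $\varepsilon$-tree. Then $\widehat{T}(\varepsilon)$ is a coarse-graining of $(T,\lambda)$, i.e. $\widehat{T}(\varepsilon)\le(T,\lambda)$.
   Context: $X$ is a finite nonempty set, $M$ a finite nonempty set of colors, $X^{\times}_{\mathrm{irr}}=\{(x,y)\in X\times X: x\neq y\}$. A phylogenetic tree on $X$ is a rooted tree whose leaves (non-root vertices of degree $1$) form $X$, whose root has degree $\ge2$ and whose non-root inner vertices have degree $\ge3$; it is determined up to isomorphism by its cluster set $\mathcal{C}(T)=\{C_T(v):v\in V(T)\}$ ($C_T(v)$ = leaves descending from $v$), and every hierarchy on $X$ is such a cluster set. $\mathrm{lca}(x,y)$ is the last common ancestor; edges are written $(\mathrm{par}(v),v)$. An edge-labeled tree $(T,\lambda)$ on $X$ with $M$ is a phylogenetic tree $T$ on $X$ with $\lambda\colon E(T)\to\mathcal{P}(M)$; $e$ is an $m$-edge if $m\in\lambda(e)$. $(T,\lambda)$ explains $\varepsilon$ if for all $(x,y)\in X^{\times}_{\mathrm{irr}}$, $m\in M$: $m\in\varepsilon(x,y)$ iff the path from $\mathrm{lca}(x,y)$ to $y$ contains an $m$-edge; $\varepsilon$ is a Fitch map if some edge-labeled tree explains it. $N_m[y]=\{x\in X\setminus\{y\}: m\notin\varepsilon(x,y)\}\cup\{y\}$, $\mathcal{N}[\varepsilon]=\{N_m[y]: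 y\in X, m\in M\}$ (hierarchy-like for Fitch maps). The $\varepsilon$-tree $\widehat{T}(\varepsilon)=(\widehat{T},\widehat{\lambda})$: $\widehat{T}$ is the phylogenetic tree with $\mathcal{C}(\widehat{T})=\mathcal{N}[\varepsilon]\cup\{X\}\cup\{\{x\}:x\in X\}$ and $\widehat{\lambda}(\mathrm{par}(v),v)=\{m\in M:\exists y\in X,\ C_{\widehat{T}}(v)=N_m[y]\}$. For edge-labeled trees $(T,\lambda),(T',\lambda')$ on $X$ with $M$, $(T',\lambda')$ is a coarse-graining of $(T,\lambda)$, written $(T',\lambda')\le(T,\lambda)$, if $\mathcal{C}(T')\subseteq\mathcal{C}(T)$ and for all non-root $v'\in V(T')$ and non-root $v\in V(T)$ with $C_T(v)=C_{T'}(v')$ we have $\lambda'(\mathrm{par}_{T'}(v'),v')\subseteq\lambda(\mathrm{par}_T(v),v)$. -}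

module Defs where

open import Data.Nat using (ℕ)
open import Data.Bool using (Bool; true; false; not; _∨_)
import Data.Bool.Properties as BoolP
open import Data.Fin using (Fin; _≟_)
open import Data.Fin.Properties using (any?)
open import Data.Fin.Subset using (Subset; _∈_; _∉_; _⊆_; ⊤; ⁅_⁆; _∩_; Nonempty; Empty)
open import Data.Fin.Subset.Properties using (_∈?_)
open import Data.Vec using (tabulate)
open import Data.Vec.Properties using (≡-dec)
open import Data.Product using (Σ; Σ-syntax; ∃; _×_)
open import Data.Sum using (_⊎_)
open import Relation.Nullary using (does; ¬_)
open import Relation.Binary.PropositionalEquality using (_≡_; _≢_)
open import Function.Bundles using (_⇔_)

-- X = Fin n, M = Fin k.  Subsets of X and of M are 'Subset' (bit vectors).

_≟ₛ_ : ∀ {n} (A B : Subset n) → Relation.Nullary.Dec (A ≡ B)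
_≟ₛ_ = ≡-dec BoolP._≟_

-- A hierarchy on X (= cluster set of a phylogenetic tree on X):
-- nonempty members, X and all singletons included, pairwise nested or disjoint.
record IsHierarchy {n : ℕ} (H : Subset n → Set) : Set where
  field
    nonempty   : ∀ C → H C → Nonempty C
    hasTop     : H ⊤
    hasSingles : ∀ x → H ⁅ x ⁆
    laminar    : ∀ C D → H C → H D → (C ⊆ D) ⊎ (D ⊆ C) ⊎ Empty (C ∩ D)

-- An edge-labeled phylogenetic tree, represented (up to isomorphism) by its
-- cluster set.  Every non-root vertex v is identified with its cluster C(v)
-- (distinct vertices of a phylogenetic tree have distinct clusters; the root
-- is the unique vertex with cluster X), and 'label C' is λ(par(v), v).
-- The value of 'label ⊤' is irrelevant (the root has no parent edge).
record EdgeLabeledTree (n k : ℕ) : Set₁ where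
  field
    clusters    : Subset n → Set
    isHierarchy : IsHierarchy clusters
    label       : Subset n → Subset k
open EdgeLabeledTree public

-- A map ε : X×X_irr → P(M); values on the diagonal are ignored.
EpsMap : ℕ → ℕ → Set
EpsMap n k = Fin n → Fin n → Subset k

-- The edges on the path from lca(x,y) to y are exactly the edges (par(v),v)
-- with y ∈ C(v) and x ∉ C(v).
Explains : ∀ {n k} → EdgeLabeledTree n k → EpsMap n k → Set
Explains T ε = ∀ (x y : Fin _) → x ≢ y → ∀ (m : Fin _) →
  (m ∈ ε x y) ⇔ (Σ[ C ∈ Subset _ ] (clusters T C × y ∈ C × x ∉ C × m ∈ label T C))

IsFitchMap : ∀ {n k} → EpsMap n k → Set₁
IsFitchMap {n} {k} ε = Σ[ T ∈ EdgeLabeledTree n k ] Explains T ε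

Nbh : ∀ {n k} → EpsMap n k → Fin k → Fin n → Subset n
Nbh ε m y = tabulate (λ x → does (x ≟ y) ∨ not (does (m ∈? ε x y)))

εClusters : ∀ {n k} → EpsMap n k → Subset n → Set
εClusters {n} {k} ε C =
  (Σ[ y ∈ Fin n ] Σ[ m ∈ Fin k ] C ≡ Nbh ε m y) ⊎ (C ≡ ⊤) ⊎ (Σ[ x ∈ Fin n ] C ≡ ⁅ x ⁆)

εLabel : ∀ {n k} → EpsMap n k → Subset n → Subset k
εLabel ε C = tabulate (λ m → does (any? (λ y → C ≟ₛ Nbh ε m y)))

CoarseGraining : ∀ {n k} → (Subset n → Set) → (Subset n → Subset k) →
                 EdgeLabeledTree n k → Set
CoarseGraining H' λ' T =
  (∀ C → H' C → clusters T C) ×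
  (∀ C → H' C → clusters T C → C ≢ ⊤ → λ' C ⊆ label T C)

{-# OPTIONS --safe #-}
module Submission where

-- For fixed y and m, the m-edges above y in T form a chain, and x ≠ y lies
-- outside N_m[y] exactly when some cluster of this chain misses x.  Hence
-- N_m[y] is the smallest cluster of the chain (or X if the chain is empty),
-- so N_m[y] is a cluster of T carrying m on its parent edge.

open import Defs
open import Level using (Level)
open import Data.Nat using (ℕ; suc)
open import Data.Bool using (Bool; T; not)
open import Data.Unit using (tt)
open import Data.Bool.Properties using (T-≡; T-∨)
open import Data.Fin using (Fin; zero; suc; _≟_)
open import Data.Fin.Properties using (any?)
open import Data.Fin.Subset using (Subset; _∈_; _∉_; _⊆_; ⊤)
open import Data.Fin.Subset.Properties using (_∈?_; ⊆⊤; ⊆-antisym; x∈p∩q⁺)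
open import Data.Vec using (tabulate)
open import Data.Vec.Properties using (lookup∘tabulate; []=⇒lookup; lookup⇒[]=)
open import Data.Product using (Σ-syntax; ∃-syntax; _×_; _,_; proj₁; proj₂)
open import Data.Sum using (_⊎_; inj₁; inj₂)
open import Data.Empty using (⊥-elim)
open import Function using (_∘_)
open import Function.Bundles using (_⇔_; mk⇔; Equivalence)
open import Function.Construct.Composition using (_⇔-∘_)
open import Data.Sum.Function.Propositional using (_⊎-⇔_)
open import Relation.Nullary using (¬_; ¬?; Dec; does; yes; no; contradiction)
open import Relation.Nullary.Decidable using (decidable-stable)
open import Relation.Unary using (Pred; Decidable)
open import Relation.Binary using (Rel; Reflexive; Transitive)
open import Relation.Binary.PropositionalEquality using (_≡_; _≢_; refl; sym; trans; subst)

open Equivalence using (to; from)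

private
  variable
    ℓ r : Level
    n k : ℕ

none⊎least : ∀ {N} {P : Pred (Fin N) ℓ} {R : Rel (Fin N) r} →
             Decidable P → Reflexive R → Transitive R →
             (∀ {a b} → P a → P b → R a b ⊎ R b a) →
             (∀ x → ¬ P x) ⊎ ∃[ x ] (P x × ∀ {z} → P z → R x z)
none⊎least {N = ℕ.zero} _ _ _ _ = inj₁ λ ()
none⊎least {N = suc N} {P = P} {R = R} P? rfl tr total
  with none⊎least {P = P ∘ suc} {R = λ a b → R (suc a) (suc b)} (P? ∘ suc) rfl tr total
     | P? zero
... | inj₁ none             | no ¬p₀ = inj₁ λ { zero → ¬p₀ ; (suc x) → none x }
... | inj₁ none             | yes p₀ = inj₂ (zero , p₀ , λ { {zero} _ → rfl ; {suc z} pz → ⊥-elim (none z pz) })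
... | inj₂ (x , px , least) | no ¬p₀ = inj₂ (suc x , px , λ { {zero} p₀ → ⊥-elim (¬p₀ p₀) ; {suc z} pz → least pz })
... | inj₂ (x , px , least) | yes p₀ with total p₀ px
...   | inj₁ R0x = inj₂ (zero , p₀ , λ { {zero} _ → rfl ; {suc z} pz → tr R0x (least pz) })
...   | inj₂ Rx0 = inj₂ (suc x , px , λ { {zero} _ → Rx0 ; {suc z} pz → least pz })

∈-tabulate : ∀ {f : Fin n → Bool} {z} → z ∈ tabulate f ⇔ T (f z)
∈-tabulate {f = f} {z} = mk⇔
  (λ z∈ → from T-≡ (trans (sym (lookup∘tabulate f z)) ([]=⇒lookup z∈)))
  (λ t → lookup⇒[]= z (tabulate f) (trans (lookup∘tabulate f z) (to T-≡ t)))

module _ {A : Set ℓ} where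

  T-does⇔ : (a? : Dec A) → T (does a?) ⇔ A
  T-does⇔ (yes a)  = mk⇔ (λ _ → a) (λ _ → tt)
  T-does⇔ (no ¬a) = mk⇔ (λ ()) ¬a

  T-not-does⇔ : (a? : Dec A) → T (not (does a?)) ⇔ (¬ A)
  T-not-does⇔ (yes a)  = mk⇔ (λ ()) (λ ¬a → ¬a a)
  T-not-does⇔ (no ¬a) = mk⇔ (λ _ → ¬a) (λ _ → tt)

overlapping⇒nested : ∀ {H : Subset n → Set} → IsHierarchy H →
                     ∀ {C D x} → H C → H D → x ∈ C → x ∈ D → C ⊆ D ⊎ D ⊆ C
overlapping⇒nested hier {C} {D} {x} hC hD x∈C x∈D
  with IsHierarchy.laminar hier C D hC hD
... | inj₁ C⊆D         = inj₁ C⊆D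
... | inj₂ (inj₁ D⊆C)  = inj₂ D⊆C
... | inj₂ (inj₂ C∩D≡∅) = ⊥-elim (C∩D≡∅ (x , x∈p∩q⁺ (x∈C , x∈D)))

module _ (ε : EpsMap n k) (m : Fin k) (y : Fin n) where

  ∈Nbh : ∀ {z} → z ∈ Nbh ε m y ⇔ (z ≡ y ⊎ m ∉ ε z y)
  ∈Nbh {z} = (T-does⇔ (z ≟ y) ⊎-⇔ T-not-does⇔ (m ∈? ε z y)) ⇔-∘ (T-∨ ⇔-∘ ∈-tabulate)

  ∉Nbh⁻ : ∀ {z} → z ∉ Nbh ε m y → z ≢ y × m ∈ ε z y
  ∉Nbh⁻ {z} z∉N = (z∉N ∘ from ∈Nbh ∘ inj₁) , decidable-stable (m ∈? ε z y) (z∉N ∘ from ∈Nbh ∘ inj₂)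

∈εLabel⁻ : ∀ {ε : EpsMap n k} {C m} → m ∈ εLabel ε C → ∃[ y ] C ≡ Nbh ε m y
∈εLabel⁻ {ε = ε} {C} {m} = to (T-does⇔ (any? λ y → C ≟ₛ Nbh ε m y)) ∘ to ∈-tabulate

MEdgeAbove : EdgeLabeledTree n k → Fin k → Fin n → Subset n → Set
MEdgeAbove T m y C = clusters T C × y ∈ C × m ∈ label T C

module _ (T : EdgeLabeledTree n k) {ε : EpsMap n k} (explains : Explains T ε)
         (m : Fin k) (y : Fin n) where

  private
    N : Subset n
    N = Nbh ε m y

  Nbh⊆MEdgeAbove : ∀ {C} → MEdgeAbove T m y C → N ⊆ C
  Nbh⊆MEdgeAbove {C} (cC , y∈C , m∈λC) {z} z∈N with z ∈? C
  ... | yes z∈C = z∈C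
  ... | no z∉C with to (∈Nbh ε m y) z∈N
  ...   | inj₁ refl = y∈C
  ...   | inj₂ m∉εzy =
          contradiction (from (explains z y (λ { refl → z∉C y∈C }) m) (C , cC , y∈C , z∉C , m∈λC)) m∉εzy

  ∉Nbh⇒separatingMEdge : ∀ {x} → x ∉ N → Σ[ C ∈ Subset n ] (MEdgeAbove T m y C × x ∉ C)
  ∉Nbh⇒separatingMEdge {x} x∉N =
    let x≢y , m∈εxy = ∉Nbh⁻ ε m y x∉N
        C , cC , y∈C , x∉C , m∈λC = to (explains x y x≢y m) m∈εxy
    in C , (cC , y∈C , m∈λC) , x∉C

  -- a separating m-edge chosen for each x outside N (junk value ⊤ for x ∈ N)
  private
    cut : Fin n → Subset n
    cut x with x ∈? N
    ... | yes _   = ⊤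
    ... | no x∉N = proj₁ (∉Nbh⇒separatingMEdge x∉N)

    cut-separates : ∀ {x} → x ∉ N → MEdgeAbove T m y (cut x) × x ∉ cut x
    cut-separates {x} x∉N with x ∈? N
    ... | yes x∈N  = contradiction x∈N x∉N
    ... | no x∉N′ = proj₂ (∉Nbh⇒separatingMEdge x∉N′)

    cuts-nested : ∀ {a b} → a ∉ N → b ∉ N → cut a ⊆ cut b ⊎ cut b ⊆ cut a
    cuts-nested a∉N b∉N =
      let (ca , y∈a , _) , _ = cut-separates a∉N
          (cb , y∈b , _) , _ = cut-separates b∉N
      in overlapping⇒nested (isHierarchy T) ca cb y∈a y∈b

  Nbh≡⊤⊎MEdgeAbove : N ≡ ⊤ ⊎ MEdgeAbove T m y N
  Nbh≡⊤⊎MEdgeAbove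
    with none⊎least {R = λ a b → cut a ⊆ cut b} (λ x → ¬? (x ∈? N)) (λ z → z) (λ r s → s ∘ r) cuts-nested
  ... | inj₁ none = inj₁ (⊆-antisym ⊆⊤ (λ {z} _ → decidable-stable (z ∈? N) (none z)))
  ... | inj₂ (x₀ , x₀∉N , least) = inj₂ (subst (MEdgeAbove T m y) (sym N≡cut) cut∈MEdgeAbove)
    where
    cut∈MEdgeAbove : MEdgeAbove T m y (cut x₀)
    cut∈MEdgeAbove = proj₁ (cut-separates x₀∉N)

    -- every z outside N is already outside the least cut
    cut⊆N : cut x₀ ⊆ N
    cut⊆N {z} z∈cut = decidable-stable (z ∈? N) λ z∉N → proj₂ (cut-separates z∉N) (least z∉N z∈cut)

    N≡cut : N ≡ cut x₀
    N≡cut = ⊆-antisym (Nbh⊆MEdgeAbove cut∈MEdgeAbove) cut⊆N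

proposition3 : ∀ {n k : ℕ} (ε : EpsMap (suc n) (suc k)) → IsFitchMap ε →
    (T : EdgeLabeledTree (suc n) (suc k)) → Explains T ε →
    CoarseGraining (εClusters ε) (εLabel ε) T
proposition3 ε _ T explains = εClusters⊆clusters , εLabel⊆label
  where
  open IsHierarchy (isHierarchy T)

  εClusters⊆clusters : ∀ C → εClusters ε C → clusters T C
  εClusters⊆clusters _ (inj₁ (y , m , refl)) with Nbh≡⊤⊎MEdgeAbove T explains m y
  ... | inj₁ N≡⊤          = subst (clusters T) (sym N≡⊤) hasTop
  ... | inj₂ (cN , _ , _) = cN
  εClusters⊆clusters _ (inj₂ (inj₁ refl))       = hasTop
  εClusters⊆clusters _ (inj₂ (inj₂ (x , refl))) = hasSingles x

  εLabel⊆label : ∀ C → εClusters ε C → clusters T C → C ≢ ⊤ → εLabel ε C ⊆ label T C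
  εLabel⊆label C _ _ C≢⊤ {m} m∈λ̂C with ∈εLabel⁻ {ε = ε} m∈λ̂C
  ... | y , refl with Nbh≡⊤⊎MEdgeAbove T explains m y
  ...   | inj₁ N≡⊤             = contradiction N≡⊤ C≢⊤
  ...   | inj₂ (_ , _ , m∈λN) = m∈λN
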